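{- Let $\frac{r}{s}$ and $\frac{r'}{s'}$ be rational numbers greater than $1$ (with $r,s$ and $r',s'$ coprime positive integers) such that $\frac{r}{s}>\frac{r'}{s'}$, and write $\left[\frac{r}{s}\right]_q=\frac{\mathcal R}{\mathcal S}$, $\left[\frac{r'}{s'}\right]_q=\frac{\mathcal R'}{\mathcal S'}$. Then the polynomial $$\mathcal X_{\frac rs,\frac{r'}{s'}}:=\mathcal R\mathcal S'-\mathcal S\mathcal R'$$ has positive integer coefficients (i.e., every nonzero coefficient is a positive integer).
   Context: $q$ is a formal variable and $[a]_q=1+q+\cdots+q^{a-1}$ for a positive integer $a$. Every rational $r/s>1$ has a unique negative continued fraction expansion $r/s=\llbracket c_1,\ldots,c_k\rrbracket=c_1-\cfrac{1}{c_2-\cfrac{1}{\ddots-\cfrac{1}{c_k}}}$ with integers $c_i\ge 2$. Its $q$-deformation is the rational function $$\left[\tfrac{r}{s}\right]_q:=[c_1]_q-\cfrac{q^{c_1-1}}{[c_2]_q-\cfrac{q^{c_2-1}}{\ddots-\cfrac{q^{c_{k-1}-1}}{[c_k]_q}}},$$ written as $\frac{\mathcal R(q)}{\mathcal S(q)}$ with $\mathcal R,\mathcal S\in\mathbb Z[q]$ coprime and normalized by $\mathcal R(1)=r$, $\mathcal S(1)=s$. -}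

module Defs where

open import Data.Nat as ℕ using (ℕ; zero; suc)
open import Data.Integer as ℤ using (ℤ; +_; -_)
open import Data.List using (List; []; _∷_; map; replicate; _++_; foldr)
open import Data.List.Relation.Unary.All using (All)
open import Data.Product using (_×_; _,_; proj₁; proj₂)
open import Data.Sum using (_⊎_)
open import Relation.Binary.PropositionalEquality using (_≡_)

-- Polynomials in ℤ[q], as coefficient lists (constant term first).
-- Trailing zeros are allowed; equality is coefficientwise (_≈P_).
Poly : Set
Poly = List ℤ

coeff : Poly → ℕ → ℤ
coeff []       _       = + 0
coeff (a ∷ p)  zero    = a
coeff (a ∷ p)  (suc i) = coeff p i

_≈P_ : Poly → Poly → Set
p ≈P p' = ∀ i → coeff p i ≡ coeff p' i

infix 4 _≈P_
infixl 6 _+P_ _-P_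
infixl 7 _*P_

_+P_ : Poly → Poly → Poly
[]      +P p'       = p'
(a ∷ p) +P []       = a ∷ p
(a ∷ p) +P (b ∷ p') = (a ℤ.+ b) ∷ (p +P p')

negP : Poly → Poly
negP = map (-_)

_-P_ : Poly → Poly → Poly
p -P p' = p +P negP p'

_*P_ : Poly → Poly → Poly
[]      *P p' = []
(a ∷ p) *P p' = map (a ℤ.*_) p' +P (+ 0 ∷ (p *P p'))

qint : ℕ → Poly
qint a = replicate a (+ 1)

qpow : ℕ → Poly
qpow n = replicate n (+ 0) ++ (+ 1 ∷ [])

ev1 : Poly → ℤ
ev1 = foldr ℤ._+_ (+ 0)

PolyCoprime : Poly → Poly → Set
PolyCoprime R S = ∀ (D A B : Poly) → D *P A ≈P R → D *P B ≈P S →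
  (D ≈P (+ 1 ∷ [])) ⊎ (D ≈P (- (+ 1) ∷ []))

-- Negative continued fraction ⟦c₁,…,c_k⟧ (c₁ = c, rest = cs), evaluated as
-- (numerator , denominator) over ℤ:  ⟦c⟧ = c/1,  c - 1/(n/d) = (c n - d)/n.
cfVal : ℕ → List ℕ → ℤ × ℤ
cfVal c []       = (+ c , + 1)
cfVal c (d ∷ cs) = let nd = cfVal d cs in
  ((+ c) ℤ.* proj₁ nd ℤ.- proj₂ nd , proj₁ nd)

IsNCF : ℕ → ℕ → ℕ → List ℕ → Set
IsNCF r s c cs = All (2 ℕ.≤_) (c ∷ cs) ×
  ((+ r) ℤ.* proj₂ (cfVal c cs) ≡ (+ s) ℤ.* proj₁ (cfVal c cs))

-- Literal evaluation of the q-deformed continued fraction as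
-- (numerator , denominator) polynomials (not reduced):
--   [c_k]_q / 1 ,   [c]_q - q^(c-1) / (N/D) = ([c]_q N - q^(c-1) D) / N.
qcf : ℕ → List ℕ → Poly × Poly
qcf c []       = (qint c , + 1 ∷ [])
qcf c (d ∷ cs) = let ND = qcf d cs in
  (qint c *P proj₁ ND -P qpow (c ℕ.∸ 1) *P proj₂ ND , proj₁ ND)

-- R/S is [r/s]_q written in lowest terms with R(1) = r, S(1) = s,
-- where (c ∷ cs) is the negative continued fraction expansion of r/s.
IsQRat : ℕ → ℕ → ℕ → List ℕ → Poly → Poly → Set
IsQRat r s c cs R S =
  ev1 R ≡ + r × ev1 S ≡ + s × PolyCoprime R S ×
  (R *P proj₂ (qcf c cs) ≈P S *P proj₁ (qcf c cs))

-- Both r/s and [r/s]_q are computed from the negative continued fraction by the same recursion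
-- (N , D) ↦ ([c] N − q^(c−1) D , N), started at ∞ = 1/0.  For the q-version N, D and N − D have
-- nonnegative coefficients, N(0) = 1, and the continuant determinants give a Bezout identity
-- N U − D V = q^m; hence the literal q-fraction is already in lowest terms and equals R/S.
-- For two expansions, 𝒳 = N D' − D N' is then handled by comparing first entries c, c': r/s > r'/s'
-- forces c ≥ c'; if c = c' the determinant is q^(c−1) times that of the tails (whose order is
-- preserved), and if c > c' it is an explicit sum of products of nonnegative polynomials.

module Submission where

open import Defs
open import Data.Nat using (ℕ; _<_; _*_)
open import Data.Nat.Coprimality using (Coprime)
open import Data.Integer as ℤ using (+_)
open import Data.List using (List)

open import Algebra.Bundles using (CommutativeRing)
open import Data.Integer as ℤ using (ℤ; -_)
import Data.Integer.Properties as ℤ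
open import Data.Integer.Tactic.RingSolver using (solve-∀)
open import Data.List using ([]; _∷_; map)
open import Data.List.Relation.Unary.All using (All; []; _∷_)
open import Data.Maybe using (Maybe; just; nothing)
open import Data.Nat as ℕ using (zero; suc; _∸_)
import Data.Nat.Properties as ℕ
open import Data.Product using (Σ; _×_; _,_; proj₁; proj₂)
open import Data.Sum using ([_,_]′)
open import Relation.Binary.Definitions using (Tri; tri<; tri≈; tri>)
open import Relation.Binary.PropositionalEquality
import Relation.Binary.Reasoning.Setoid as SetoidReasoning
open import Relation.Nullary using (¬_; contradiction; yes; no)
open import Tactic.RingSolver.Core.AlmostCommutativeRing using (AlmostCommutativeRing; fromCommutativeRing)
import Tactic.RingSolver as PolyRingSolver

-- A record rather than _≈P_ itself, so that both sides can be inferred from a proof and the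
-- reflective ring solver sees a relation applied to two polynomials.
infix 4 _≋_
record _≋_ (p q : Poly) : Set where
  constructor coeffwise
  field at : p ≈P q
open _≋_

≋-refl : ∀ {p} → p ≋ p
≋-refl = coeffwise λ _ → refl

≋-sym : ∀ {p q} → p ≋ q → q ≋ p
≋-sym e = coeffwise λ i → sym (at e i)

≋-trans : ∀ {p q r} → p ≋ q → q ≋ r → p ≋ r
≋-trans e f = coeffwise λ i → trans (at e i) (at f i)

∷-cong : ∀ {a b p q} → a ≡ b → p ≋ q → a ∷ p ≋ b ∷ q
∷-cong a≡b e = coeffwise λ { zero → a≡b ; (suc i) → at e i }

∷-injectiveʳ : ∀ {a b p q} → a ∷ p ≋ b ∷ q → p ≋ q
∷-injectiveʳ e = coeffwise λ i → at e (suc i)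

0∷-null : ∀ {p} → p ≋ [] → + 0 ∷ p ≋ []
0∷-null e = coeffwise λ { zero → refl ; (suc i) → at e i }

infixr 8 _·P_
_·P_ : ℤ → Poly → Poly
a ·P p = map (a ℤ.*_) p

coeff-+P : ∀ p q i → coeff (p +P q) i ≡ coeff p i ℤ.+ coeff q i
coeff-+P []      q       i       = sym (ℤ.+-identityˡ _)
coeff-+P (a ∷ p) []      i       = sym (ℤ.+-identityʳ _)
coeff-+P (a ∷ p) (b ∷ q) zero    = refl
coeff-+P (a ∷ p) (b ∷ q) (suc i) = coeff-+P p q i

coeff-negP : ∀ p i → coeff (negP p) i ≡ - coeff p i
coeff-negP []      i       = refl
coeff-negP (a ∷ p) zero    = refl
coeff-negP (a ∷ p) (suc i) = coeff-negP p i

coeff-·P : ∀ a p i → coeff (a ·P p) i ≡ a ℤ.* coeff p i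
coeff-·P a []      i       = sym (ℤ.*-zeroʳ a)
coeff-·P a (b ∷ p) zero    = refl
coeff-·P a (b ∷ p) (suc i) = coeff-·P a p i

+P-cong : ∀ {p p' q q'} → p ≋ p' → q ≋ q' → p +P q ≋ p' +P q'
+P-cong {p} {p'} {q} {q'} e f = coeffwise λ i →
  trans (coeff-+P p q i) (trans (cong₂ ℤ._+_ (at e i) (at f i)) (sym (coeff-+P p' q' i)))

negP-cong : ∀ {p q} → p ≋ q → negP p ≋ negP q
negP-cong {p} {q} e = coeffwise λ i →
  trans (coeff-negP p i) (trans (cong -_ (at e i)) (sym (coeff-negP q i)))

·P-congʳ : ∀ a {p q} → p ≋ q → a ·P p ≋ a ·P q
·P-congʳ a {p} {q} e = coeffwise λ i →
  trans (coeff-·P a p i) (trans (cong (a ℤ.*_) (at e i)) (sym (coeff-·P a q i)))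

0·P-null : ∀ p → (+ 0) ·P p ≋ []
0·P-null p = coeffwise (coeff-·P (+ 0) p)

+P-comm : ∀ p q → p +P q ≋ q +P p
+P-comm p q = coeffwise λ i →
  trans (coeff-+P p q i) (trans (ℤ.+-comm (coeff p i) (coeff q i)) (sym (coeff-+P q p i)))

+P-assoc : ∀ p q r → (p +P q) +P r ≋ p +P (q +P r)
+P-assoc p q r = coeffwise λ i → begin
  coeff ((p +P q) +P r) i                      ≡⟨ coeff-+P (p +P q) r i ⟩
  coeff (p +P q) i ℤ.+ coeff r i               ≡⟨ cong (ℤ._+ coeff r i) (coeff-+P p q i) ⟩
  (coeff p i ℤ.+ coeff q i) ℤ.+ coeff r i      ≡⟨ ℤ.+-assoc (coeff p i) (coeff q i) (coeff r i) ⟩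
  coeff p i ℤ.+ (coeff q i ℤ.+ coeff r i)      ≡⟨ cong (ℤ._+_ (coeff p i)) (coeff-+P q r i) ⟨
  coeff p i ℤ.+ coeff (q +P r) i               ≡⟨ coeff-+P p (q +P r) i ⟨
  coeff (p +P (q +P r)) i                      ∎
  where open ≡-Reasoning

+P-identityʳ : ∀ p → p +P [] ≋ p
+P-identityʳ p = coeffwise λ i → trans (coeff-+P p [] i) (ℤ.+-identityʳ _)

+P-inverseʳ : ∀ p → p -P p ≋ []
+P-inverseʳ p = coeffwise λ i →
  trans (coeff-+P p (negP p) i) (trans (cong (ℤ._+_ (coeff p i)) (coeff-negP p i)) (ℤ.+-inverseʳ (coeff p i)))

·P-distrib-+P : ∀ a p q → a ·P (p +P q) ≋ a ·P p +P a ·P q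
·P-distrib-+P a p q = coeffwise λ i → begin
  coeff (a ·P (p +P q)) i                       ≡⟨ coeff-·P a (p +P q) i ⟩
  a ℤ.* coeff (p +P q) i                        ≡⟨ cong (a ℤ.*_) (coeff-+P p q i) ⟩
  a ℤ.* (coeff p i ℤ.+ coeff q i)               ≡⟨ ℤ.*-distribˡ-+ a (coeff p i) (coeff q i) ⟩
  a ℤ.* coeff p i ℤ.+ a ℤ.* coeff q i           ≡⟨ cong₂ ℤ._+_ (coeff-·P a p i) (coeff-·P a q i) ⟨
  coeff (a ·P p) i ℤ.+ coeff (a ·P q) i         ≡⟨ coeff-+P (a ·P p) (a ·P q) i ⟨
  coeff (a ·P p +P a ·P q) i                    ∎
  where open ≡-Reasoning

*-·P-assoc : ∀ a b p → (a ℤ.* b) ·P p ≋ a ·P b ·P p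
*-·P-assoc a b p = coeffwise λ i →
  trans (coeff-·P (a ℤ.* b) p i) (trans (ℤ.*-assoc a b (coeff p i))
    (sym (trans (coeff-·P a (b ·P p) i) (cong (a ℤ.*_) (coeff-·P b p i)))))

+P-left-commute : ∀ p q r → p +P (q +P r) ≋ q +P (p +P r)
+P-left-commute p q r =
  ≋-trans (≋-sym (+P-assoc p q r)) (≋-trans (+P-cong (+P-comm p q) ≋-refl) (+P-assoc q p r))

+P-interchange : ∀ p q r t → (p +P q) +P (r +P t) ≋ (p +P r) +P (q +P t)
+P-interchange p q r t = ≋-trans (+P-assoc p q (r +P t))
  (≋-trans (+P-cong (≋-refl {p}) (+P-left-commute q r t)) (≋-sym (+P-assoc p r (q +P t))))

*P-zeroʳ : ∀ p → p *P [] ≋ []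
*P-zeroʳ []      = ≋-refl
*P-zeroʳ (a ∷ p) = 0∷-null (*P-zeroʳ p)

*P-congʳ : ∀ p {q q'} → q ≋ q' → p *P q ≋ p *P q'
*P-congʳ []      e = ≋-refl
*P-congʳ (a ∷ p) e = +P-cong (·P-congʳ a e) (∷-cong refl (*P-congʳ p e))

0∷-*P : ∀ p q → (+ 0 ∷ p) *P q ≋ + 0 ∷ p *P q
0∷-*P p q = +P-cong (0·P-null q) ≋-refl

*P-∷ʳ : ∀ p b q → p *P (b ∷ q) ≋ b ·P p +P (+ 0 ∷ p *P q)
*P-∷ʳ []      b q = ≋-sym (0∷-null ≋-refl)
*P-∷ʳ (a ∷ p) b q = ∷-cong (cong (ℤ._+ + 0) (ℤ.*-comm a b))
  (≋-trans (+P-cong (≋-refl {a ·P q}) (*P-∷ʳ p b q)) (+P-left-commute (a ·P q) (b ·P p) (+ 0 ∷ p *P q)))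

*P-comm : ∀ p q → p *P q ≋ q *P p
*P-comm []      q = ≋-sym (*P-zeroʳ q)
*P-comm (a ∷ p) q = ≋-trans (+P-cong (≋-refl {a ·P q}) (∷-cong refl (*P-comm p q))) (≋-sym (*P-∷ʳ q a p))

*P-congˡ : ∀ {p p'} q → p ≋ p' → p *P q ≋ p' *P q
*P-congˡ {p} {p'} q e = ≋-trans (*P-comm p q) (≋-trans (*P-congʳ q e) (*P-comm q p'))

*P-cong : ∀ {p p' q q'} → p ≋ p' → q ≋ q' → p *P q ≋ p' *P q'
*P-cong {p' = p'} {q} e f = ≋-trans (*P-congˡ q e) (*P-congʳ p' f)

*P-distribˡ-+P : ∀ r p q → r *P (p +P q) ≋ r *P p +P r *P q
*P-distribˡ-+P []      p q = ≋-refl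
*P-distribˡ-+P (a ∷ r) p q =
  ≋-trans (+P-cong (·P-distrib-+P a p q) (∷-cong (sym (ℤ.+-identityʳ (+ 0))) (*P-distribˡ-+P r p q)))
          (+P-interchange (a ·P p) (a ·P q) (+ 0 ∷ r *P p) (+ 0 ∷ r *P q))

*P-distribʳ-+P : ∀ r p q → (p +P q) *P r ≋ p *P r +P q *P r
*P-distribʳ-+P r p q =
  ≋-trans (*P-comm (p +P q) r) (≋-trans (*P-distribˡ-+P r p q) (+P-cong (*P-comm r p) (*P-comm r q)))

·P-*P-assoc : ∀ a p q → (a ·P p) *P q ≋ a ·P (p *P q)
·P-*P-assoc a []      q = ≋-refl
·P-*P-assoc a (b ∷ p) q =
  ≋-trans (+P-cong (*-·P-assoc a b q) (∷-cong (sym (ℤ.*-zeroʳ a)) (·P-*P-assoc a p q)))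
          (≋-sym (·P-distrib-+P a (b ·P q) (+ 0 ∷ p *P q)))

*P-assoc : ∀ p q r → (p *P q) *P r ≋ p *P (q *P r)
*P-assoc []      q r = ≋-refl
*P-assoc (a ∷ p) q r = ≋-trans (*P-distribʳ-+P r (a ·P q) (+ 0 ∷ p *P q))
  (+P-cong (·P-*P-assoc a q r) (≋-trans (0∷-*P (p *P q) r) (∷-cong refl (*P-assoc p q r))))

*P-identityˡ : ∀ p → (+ 1 ∷ []) *P p ≋ p
*P-identityˡ p = ≋-trans (+P-cong (coeffwise λ i → trans (coeff-·P (+ 1) p i) (ℤ.*-identityˡ (coeff p i)))
                                  (0∷-null ≋-refl))
                         (+P-identityʳ p)

Poly-commutativeRing : CommutativeRing _ _
Poly-commutativeRing = record
  { Carrier = Poly ; _≈_ = _≋_ ; _+_ = _+P_ ; _*_ = _*P_ ; -_ = negP ; 0# = [] ; 1# = + 1 ∷ []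
  ; isCommutativeRing = record
    { isRing = record
      { +-isAbelianGroup = record
        { isGroup = record
          { isMonoid = record
            { isSemigroup = record
              { isMagma = record
                { isEquivalence = record { refl = ≋-refl ; sym = ≋-sym ; trans = ≋-trans }
                ; ∙-cong = +P-cong }
              ; assoc = +P-assoc }
            ; identity = (λ _ → ≋-refl) , +P-identityʳ }
          ; inverse = (λ p → ≋-trans (+P-comm (negP p) p) (+P-inverseʳ p)) , +P-inverseʳ
          ; ⁻¹-cong = negP-cong }
        ; comm = +P-comm }
      ; *-cong = *P-cong
      ; *-assoc = *P-assoc
      ; *-identity = *P-identityˡ , (λ p → ≋-trans (*P-comm p _) (*P-identityˡ p))
      ; distrib = *P-distribˡ-+P , *P-distribʳ-+P }
    ; *-comm = *P-comm } }

Poly-almostCommutativeRing : AlmostCommutativeRing _ _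
Poly-almostCommutativeRing = fromCommutativeRing Poly-commutativeRing null?
  where
  -- The solver cancels monomials only when it can recognise their coefficients as zero.
  null? : ∀ p → Maybe ([] ≋ p)
  null? [] = just ≋-refl
  null? (a ∷ p) with a ℤ.≟ + 0 | null? p
  ... | yes refl | just e = just (coeffwise λ { zero → refl ; (suc i) → at e i })
  ... | _ | _ = nothing

q : Poly
q = qpow 1

q*P≋0∷ : ∀ p → q *P p ≋ + 0 ∷ p
q*P≋0∷ p = ≋-trans (0∷-*P (+ 1 ∷ []) p) (∷-cong refl (*P-identityˡ p))

qpow-suc : ∀ n → qpow (suc n) ≋ q *P qpow n
qpow-suc n = ≋-sym (q*P≋0∷ (qpow n))

qint-suc : ∀ n → qint (suc n) ≋ qint n +P qpow n
qint-suc zero    = ≋-refl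
qint-suc (suc n) = ∷-cong refl (qint-suc n)

qpow-+ : ∀ a b → qpow (a ℕ.+ b) ≋ qpow a *P qpow b
qpow-+ zero    b = ≋-sym (*P-identityˡ (qpow b))
qpow-+ (suc a) b = ≋-trans (∷-cong refl (qpow-+ a b)) (≋-sym (0∷-*P (qpow a) (qpow b)))

qint-+ : ∀ a b → qint (a ℕ.+ b) ≋ qint a +P qpow a *P qint b
qint-+ zero    b = ≋-sym (*P-identityˡ (qint b))
qint-+ (suc a) b = ≋-trans (∷-cong refl (qint-+ a b)) (+P-cong (≋-refl {+ 1 ∷ qint a}) (≋-sym (0∷-*P (qpow a) (qint b))))

record NonNeg (p : Poly) : Set where
  constructor nonNeg
  field coeff-nonNeg : ∀ i → + 0 ℤ.≤ coeff p i
open NonNeg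

0≤+ : ∀ n → + 0 ℤ.≤ + n
0≤+ n = ℤ.+≤+ ℕ.z≤n

+-pres-0≤ : ∀ {a b} → + 0 ℤ.≤ a → + 0 ℤ.≤ b → + 0 ℤ.≤ a ℤ.+ b
+-pres-0≤ {+ m} {+ n} _ _ = subst (+ 0 ℤ.≤_) (ℤ.pos-+ m n) (0≤+ (m ℕ.+ n))

*-pres-0≤ : ∀ {a b} → + 0 ℤ.≤ a → + 0 ℤ.≤ b → + 0 ℤ.≤ a ℤ.* b
*-pres-0≤ {+ m} {+ n} _ _ = subst (+ 0 ℤ.≤_) (ℤ.pos-* m n) (0≤+ (m ℕ.* n))

nonNeg-cong : ∀ {p p'} → p ≋ p' → NonNeg p → NonNeg p'
nonNeg-cong e h = nonNeg λ i → subst (+ 0 ℤ.≤_) (at e i) (coeff-nonNeg h i)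

nonNeg-+P : ∀ {p p'} → NonNeg p → NonNeg p' → NonNeg (p +P p')
nonNeg-+P {p} {p'} h h' = nonNeg λ i →
  subst (+ 0 ℤ.≤_) (sym (coeff-+P p p' i)) (+-pres-0≤ (coeff-nonNeg h i) (coeff-nonNeg h' i))

nonNeg-0∷ : ∀ {p} → NonNeg p → NonNeg (+ 0 ∷ p)
nonNeg-0∷ h = nonNeg λ { zero → 0≤+ 0 ; (suc i) → coeff-nonNeg h i }

nonNeg-*P : ∀ {p p'} → NonNeg p → NonNeg p' → NonNeg (p *P p')
nonNeg-*P {[]}    h h' = nonNeg λ _ → 0≤+ 0
nonNeg-*P {a ∷ p} {p'} h h' = nonNeg-+P
  (nonNeg λ i → subst (+ 0 ℤ.≤_) (sym (coeff-·P a p' i)) (*-pres-0≤ (coeff-nonNeg h 0) (coeff-nonNeg h' i)))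
  (nonNeg-0∷ (nonNeg-*P {p} (nonNeg λ i → coeff-nonNeg h (suc i)) h'))

nonNeg-qint : ∀ n → NonNeg (qint n)
nonNeg-qint zero    = nonNeg λ _ → 0≤+ 0
nonNeg-qint (suc n) = nonNeg λ { zero → 0≤+ 1 ; (suc i) → coeff-nonNeg (nonNeg-qint n) i }

nonNeg-qpow : ∀ n → NonNeg (qpow n)
nonNeg-qpow zero    = nonNeg λ { zero → 0≤+ 1 ; (suc i) → 0≤+ 0 }
nonNeg-qpow (suc n) = nonNeg-0∷ (nonNeg-qpow n)

-- (n , d) stands for n/d with d ≥ 0, possibly d = 0; such fractions are compared by cross-multiplying.
infix 4 _≻_
_≻_ : ℤ × ℤ → ℤ × ℤ → Set
x ≻ y = proj₁ y ℤ.* proj₂ x ℤ.< proj₁ x ℤ.* proj₂ y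

AboveOne : ℤ × ℤ → Set
AboveOne x = + 0 ℤ.≤ proj₂ x × proj₂ x ℤ.< proj₁ x

stepℤ : ℕ → ℤ × ℤ → ℤ × ℤ
stepℤ d x = + d ℤ.* proj₁ x ℤ.- proj₂ x , proj₁ x

-- The empty expansion stands for ∞ = 1/0, so that every expansion is stepℤ applied to its tail.
cfℤ : List ℕ → ℤ × ℤ
cfℤ []       = + 1 , + 0
cfℤ (d ∷ ds) = cfVal d ds

cfℤ-∷ : ∀ d ds → cfℤ (d ∷ ds) ≡ stepℤ d (cfℤ ds)
cfℤ-∷ d []       = cong (_, + 1) (sym (trans (ℤ.+-identityʳ _) (ℤ.*-identityʳ (+ d))))
cfℤ-∷ d (e ∷ es) = refl

i<i+j : ∀ i {j} → + 0 ℤ.< j → i ℤ.< i ℤ.+ j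
i<i+j i {j} 0<j = subst (ℤ._< i ℤ.+ j) (ℤ.+-identityʳ i) (ℤ.+-monoʳ-< i 0<j)

i<j⇒0<j-i : ∀ {i j} → i ℤ.< j → + 0 ℤ.< j ℤ.- i
i<j⇒0<j-i {i} {j} i<j = subst (ℤ._< j ℤ.- i) (ℤ.+-inverseʳ i) (ℤ.+-monoˡ-< (- i) i<j)

stepℤ-aboveOne : ∀ {d x} → 2 ℕ.≤ d → AboveOne x → AboveOne (stepℤ d x)
stepℤ-aboveOne {suc (suc k)} {m , e} (ℕ.s≤s (ℕ.s≤s ℕ.z≤n)) (0≤e , e<m) =
  0≤m , subst (m ℤ.<_) (sym gap) (i<i+j m (ℤ.<-≤-trans (i<j⇒0<j-i e<m) (ℤ.i≤i+j _ _ {{ℤ.nonNegative 0≤km}})))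
  where
  0≤m : + 0 ℤ.≤ m
  0≤m = ℤ.≤-trans 0≤e (ℤ.<⇒≤ e<m)
  0≤km : + 0 ℤ.≤ + k ℤ.* m
  0≤km = *-pres-0≤ (0≤+ k) 0≤m
  gap : + suc (suc k) ℤ.* m ℤ.- e ≡ m ℤ.+ ((m ℤ.- e) ℤ.+ + k ℤ.* m)
  gap = trans (cong (λ d → d ℤ.* m ℤ.- e) (ℤ.pos-+ 2 k)) (identity (+ k) m e)
    where
    identity : ∀ k m e → (+ 2 ℤ.+ k) ℤ.* m ℤ.- e ≡ m ℤ.+ ((m ℤ.- e) ℤ.+ k ℤ.* m)
    identity = solve-∀

cfℤ-aboveOne : ∀ {ds} → All (2 ℕ.≤_) ds → AboveOne (cfℤ ds)
cfℤ-aboveOne []                  = 0≤+ 0 , ℤ.+<+ (ℕ.s≤s ℕ.z≤n)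
cfℤ-aboveOne {d ∷ ds} (2≤d ∷ hs) = subst AboveOne (sym (cfℤ-∷ d ds)) (stepℤ-aboveOne 2≤d (cfℤ-aboveOne hs))

cfℤ-den-pos : ∀ {d ds} → All (2 ℕ.≤_) (d ∷ ds) → + 0 ℤ.< proj₂ (cfℤ (d ∷ ds))
cfℤ-den-pos {d} {ds} (_ ∷ hs) = let 0≤e , e<m = cfℤ-aboveOne hs in
  subst (λ x → + 0 ℤ.< proj₂ x) (sym (cfℤ-∷ d ds)) (ℤ.≤-<-trans 0≤e e<m)

≻-∞-impossible : ∀ {x} → + 0 ℤ.≤ proj₂ x → ¬ (x ≻ cfℤ [])
≻-∞-impossible {m , e} 0≤e e<0 = ℤ.<⇒≱ (subst₂ ℤ._<_ (ℤ.*-identityˡ e) (ℤ.*-zeroʳ m) e<0) 0≤e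

stepℤ-≻-tail : ∀ d x y → stepℤ d x ≻ stepℤ d y → x ≻ y
stepℤ-≻-tail d (m , e) (m' , e') lt = subst₂ ℤ._<_ (lhs (+ d) m e m' e') (rhs (+ d) m e m' e') (ℤ.+-monoˡ-< shift lt)
  where
  shift = m ℤ.* e' ℤ.+ m' ℤ.* e ℤ.- + d ℤ.* m ℤ.* m'
  lhs : ∀ d m e m' e' → (d ℤ.* m' ℤ.- e') ℤ.* m ℤ.+ (m ℤ.* e' ℤ.+ m' ℤ.* e ℤ.- d ℤ.* m ℤ.* m') ≡ m' ℤ.* e
  lhs = solve-∀
  rhs : ∀ d m e m' e' → (d ℤ.* m ℤ.- e) ℤ.* m' ℤ.+ (m ℤ.* e' ℤ.+ m' ℤ.* e ℤ.- d ℤ.* m ℤ.* m') ≡ m ℤ.* e'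
  rhs = solve-∀

stepℤ-≻-head : ∀ {d d'} x y → d ℕ.< d' → AboveOne x → AboveOne y → ¬ (stepℤ d x ≻ stepℤ d' y)
stepℤ-≻-head {d} (m , e) (m' , e') d<d' (0≤e , e<m) (0≤e' , e'<m') with ℕ.m≤n⇒∃[o]m+o≡n d<d'
... | t , refl = λ lt → ℤ.<⇒≱ lt (subst (_ ℤ.≤_) (sym split) (ℤ.i≤i+j _ gap {{ℤ.nonNegative 0≤gap}}))
  where
  0≤m  = ℤ.≤-trans 0≤e (ℤ.<⇒≤ e<m)
  0≤m' = ℤ.≤-trans 0≤e' (ℤ.<⇒≤ e'<m')
  gap = + t ℤ.* m ℤ.* m' ℤ.+ m ℤ.* (m' ℤ.- e') ℤ.+ e ℤ.* m'
  0≤gap : + 0 ℤ.≤ gap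
  0≤gap = +-pres-0≤ (+-pres-0≤ (*-pres-0≤ (*-pres-0≤ (0≤+ t) 0≤m) 0≤m')
                               (*-pres-0≤ 0≤m (ℤ.<⇒≤ (i<j⇒0<j-i e'<m'))))
                    (*-pres-0≤ 0≤e 0≤m')
  split : (+ (suc d ℕ.+ t) ℤ.* m' ℤ.- e') ℤ.* m ≡ (+ d ℤ.* m ℤ.- e) ℤ.* m' ℤ.+ gap
  split = trans (cong (λ d' → (d' ℤ.* m' ℤ.- e') ℤ.* m) (trans (ℤ.pos-+ (suc d) t) (cong (ℤ._+ + t) (ℤ.pos-+ 1 d))))
                (identity (+ d) (+ t) m e m' e')
    where
    identity : ∀ d t m e m' e' → ((+ 1 ℤ.+ d ℤ.+ t) ℤ.* m' ℤ.- e') ℤ.* m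
                                  ≡ (d ℤ.* m ℤ.- e) ℤ.* m' ℤ.+ (t ℤ.* m ℤ.* m' ℤ.+ m ℤ.* (m' ℤ.- e') ℤ.+ e ℤ.* m')
    identity = solve-∀

ratio-≻ : ∀ r s r' s' x y → + 0 ℤ.< proj₂ x → + 0 ℤ.< proj₂ y →
  + r ℤ.* proj₂ x ≡ + s ℤ.* proj₁ x → + r' ℤ.* proj₂ y ≡ + s' ℤ.* proj₁ y → r' * s < r * s' → x ≻ y
ratio-≻ r s r' s' (n , d) (n' , d') 0<d 0<d' rd≡sn r'd'≡s'n' r's<rs' =
  ℤ.*-cancelˡ-<-nonNeg (+ (s * s')) (begin-strict
    + (s * s') ℤ.* (n' ℤ.* d)    ≡⟨ lhs ⟩
    + r' ℤ.* + s ℤ.* (d ℤ.* d')  <⟨ ℤ.*-monoʳ-<-pos (d ℤ.* d') {{ℤ.positive 0<dd'}} r's<rs'ℤ ⟩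
    + r ℤ.* + s' ℤ.* (d ℤ.* d')  ≡⟨ rhs ⟩
    + (s * s') ℤ.* (n ℤ.* d')    ∎)
  where
  open ℤ.≤-Reasoning
  0<dd' : + 0 ℤ.< d ℤ.* d'
  0<dd' = ℤ.*-monoʳ-<-pos d' {{ℤ.positive 0<d'}} 0<d
  r's<rs'ℤ : + r' ℤ.* + s ℤ.< + r ℤ.* + s'
  r's<rs'ℤ = subst₂ ℤ._<_ (ℤ.pos-* r' s) (ℤ.pos-* r s') (ℤ.+<+ r's<rs')
  lhs : + (s * s') ℤ.* (n' ℤ.* d) ≡ + r' ℤ.* + s ℤ.* (d ℤ.* d')
  lhs = trans (cong (ℤ._* (n' ℤ.* d)) (ℤ.pos-* s s'))
        (trans (regroup₁ (+ s) (+ s') n' d) (trans (cong (λ z → + s ℤ.* d ℤ.* z) (sym r'd'≡s'n')) (regroup₂ (+ s) d (+ r') d')))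
    where
    regroup₁ : ∀ s s' n' d → s ℤ.* s' ℤ.* (n' ℤ.* d) ≡ s ℤ.* d ℤ.* (s' ℤ.* n')
    regroup₁ = solve-∀
    regroup₂ : ∀ s d r' d' → s ℤ.* d ℤ.* (r' ℤ.* d') ≡ r' ℤ.* s ℤ.* (d ℤ.* d')
    regroup₂ = solve-∀
  rhs : + r ℤ.* + s' ℤ.* (d ℤ.* d') ≡ + (s * s') ℤ.* (n ℤ.* d')
  rhs = trans (regroup₁ (+ r) (+ s') d d') (trans (cong (λ z → + s' ℤ.* d' ℤ.* z) rd≡sn)
        (trans (regroup₂ (+ s') d' (+ s) n) (cong (ℤ._* (n ℤ.* d')) (sym (ℤ.pos-* s s')))))
    where
    regroup₁ : ∀ r s' d d' → r ℤ.* s' ℤ.* (d ℤ.* d') ≡ s' ℤ.* d' ℤ.* (r ℤ.* d)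
    regroup₁ = solve-∀
    regroup₂ : ∀ s' d' s n → s' ℤ.* d' ℤ.* (s ℤ.* n) ≡ s ℤ.* s' ℤ.* (n ℤ.* d')
    regroup₂ = solve-∀

infix 4 _≋²_
_≋²_ : Poly × Poly → Poly × Poly → Set
x ≋² y = proj₁ x ≋ proj₁ y × proj₂ x ≋ proj₂ y

≋²-sym : ∀ {x y} → x ≋² y → y ≋² x
≋²-sym (n≋ , d≋) = ≋-sym n≋ , ≋-sym d≋

stepq : ℕ → Poly × Poly → Poly × Poly
stepq d x = qint d *P proj₁ x -P qpow (d ∸ 1) *P proj₂ x , proj₁ x

cfq : List ℕ → Poly × Poly
cfq []       = + 1 ∷ [] , []
cfq (d ∷ ds) = qcf d ds

cfq-∷ : ∀ d ds → cfq (d ∷ ds) ≋² stepq d (cfq ds)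
cfq-∷ d []       = ≋-sym (identity (qint d) (qpow (d ∸ 1))) , ≋-refl
  where
  identity : ∀ c Q → c *P (+ 1 ∷ []) -P Q *P [] ≋ c
  identity = PolyRingSolver.solve-∀ Poly-almostCommutativeRing
cfq-∷ d (e ∷ es) = ≋-refl , ≋-refl

det : Poly × Poly → Poly × Poly → Poly
det x y = proj₁ x *P proj₂ y -P proj₂ x *P proj₁ y

det-cong : ∀ {x x' y y'} → x ≋² x' → y ≋² y' → det x y ≋ det x' y'
det-cong (n≋ , d≋) (n'≋ , d'≋) = +P-cong (*P-cong n≋ d'≋) (negP-cong (*P-cong d≋ n'≋))

det-∞ : ∀ y → det (cfq []) y ≋ proj₂ y
det-∞ (n , d) = identity n d
  where
  identity : ∀ n d → (+ 1 ∷ []) *P d -P [] *P n ≋ d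
  identity = PolyRingSolver.solve-∀ Poly-almostCommutativeRing

det-stepq : ∀ d x y → det (stepq d x) (stepq d y) ≋ qpow (d ∸ 1) *P det x y
det-stepq d (n , e) (n' , e') = identity (qint d) (qpow (d ∸ 1)) n e n' e'
  where
  identity : ∀ c Q n e n' e' → (c *P n -P Q *P e) *P n' -P n *P (c *P n' -P Q *P e') ≋ Q *P (n *P e' -P e *P n')
  identity = PolyRingSolver.solve-∀ Poly-almostCommutativeRing

record WellShaped (x : Poly × Poly) : Set where
  field
    num-nonNeg     : NonNeg (proj₁ x)
    den-nonNeg     : NonNeg (proj₂ x)
    num-den-nonNeg : NonNeg (proj₁ x -P proj₂ x)
    num-constant   : coeff (proj₁ x) 0 ≡ + 1
open WellShaped

wellShaped-cong : ∀ {x y} → x ≋² y → WellShaped x → WellShaped y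
wellShaped-cong (n≋ , d≋) w = record
  { num-nonNeg     = nonNeg-cong n≋ (num-nonNeg w)
  ; den-nonNeg     = nonNeg-cong d≋ (den-nonNeg w)
  ; num-den-nonNeg = nonNeg-cong (+P-cong n≋ (negP-cong d≋)) (num-den-nonNeg w)
  ; num-constant   = trans (sym (at n≋ 0)) (num-constant w)
  }

stepq-num : ∀ k n d → proj₁ (stepq (2 ℕ.+ k) (n , d)) ≋ q *P (qint k *P n +P qpow k *P (n -P d)) +P n
stepq-num k n d = ≋-trans (+P-cong (*P-congˡ n qint-2+k) (negP-cong (*P-congˡ d (qpow-suc k))))
                              (identity q (qint k) (qpow k) n d)
  where
  qint-2+k : qint (2 ℕ.+ k) ≋ (+ 1 ∷ []) +P q *P (qint k +P qpow k)
  qint-2+k = ≋-trans (∷-cong refl (qint-suc k)) (≋-sym (+P-cong (≋-refl {+ 1 ∷ []}) (q*P≋0∷ (qint k +P qpow k))))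
  identity : ∀ q i p n d → ((+ 1 ∷ []) +P q *P (i +P p)) *P n -P (q *P p) *P d ≋ q *P (i *P n +P p *P (n -P d)) +P n
  identity = PolyRingSolver.solve-∀ Poly-almostCommutativeRing

stepq-wellShaped : ∀ {d x} → 2 ℕ.≤ d → WellShaped x → WellShaped (stepq d x)
stepq-wellShaped {suc (suc k)} {n , d} (ℕ.s≤s (ℕ.s≤s ℕ.z≤n)) w = record
  { num-nonNeg     = nonNeg-cong (≋-sym num≋) (nonNeg-+P qw-nonNeg (num-nonNeg w))
  ; den-nonNeg     = num-nonNeg w
  ; num-den-nonNeg = nonNeg-cong (≋-sym (≋-trans (+P-cong num≋ ≋-refl) (cancel (q *P W) n))) qw-nonNeg
  ; num-constant   = trans (at num≋ 0) (trans (coeff-+P (q *P W) n 0) (cong₂ ℤ._+_ (at (q*P≋0∷ W) 0) (num-constant w)))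
  }
  where
  W = qint k *P n +P qpow k *P (n -P d)
  num≋ = stepq-num k n d
  qw-nonNeg : NonNeg (q *P W)
  qw-nonNeg = nonNeg-*P (nonNeg-qpow 1) (nonNeg-+P (nonNeg-*P (nonNeg-qint k) (num-nonNeg w))
                                                   (nonNeg-*P (nonNeg-qpow k) (num-den-nonNeg w)))
  cancel : ∀ a n → a +P n -P n ≋ a
  cancel = PolyRingSolver.solve-∀ Poly-almostCommutativeRing

cfq-wellShaped : ∀ {ds} → All (2 ℕ.≤_) ds → WellShaped (cfq ds)
cfq-wellShaped [] = record
  { num-nonNeg = nonNeg-qpow 0 ; den-nonNeg = nonNeg λ _ → 0≤+ 0 ; num-den-nonNeg = nonNeg-qpow 0 ; num-constant = refl }
cfq-wellShaped {d ∷ ds} (2≤d ∷ hs) =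
  wellShaped-cong (≋²-sym (cfq-∷ d ds)) (stepq-wellShaped 2≤d (cfq-wellShaped hs))

det-stepq-nonNeg : ∀ {d d' x y} → d' ℕ.< d → 1 ℕ.≤ d' → WellShaped x → WellShaped y →
  NonNeg (det (stepq d x) (stepq d' y))
det-stepq-nonNeg {d} {suc a} {n , e} {n' , e'} d'<d _ w w' with ℕ.m≤n⇒∃[o]m+o≡n d'<d
... | k , refl = nonNeg-cong (≋-sym det≋)
  (nonNeg-+P (nonNeg-+P (nonNeg-*P (nonNeg-*P (nonNeg-*P (nonNeg-qpow (suc a)) (nonNeg-qint k)) (num-nonNeg w)) (num-nonNeg w'))
                        (nonNeg-*P (nonNeg-*P (nonNeg-*P (nonNeg-qpow (suc a)) (nonNeg-qpow k)) (num-den-nonNeg w)) (num-nonNeg w')))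
             (nonNeg-*P (nonNeg-*P (nonNeg-qpow a) (num-nonNeg w)) (den-nonNeg w')))
  where
  A = qint (suc a)
  P = qpow (suc a)
  qint-split : qint (suc (suc a) ℕ.+ k) ≋ A +P P *P (qint k +P qpow k)
  qint-split = subst (λ m → qint m ≋ A +P P *P (qint k +P qpow k)) (ℕ.+-suc (suc a) k)
                 (≋-trans (qint-+ (suc a) (suc k)) (+P-cong (≋-refl {A}) (*P-congʳ P (qint-suc k))))
  identity : ∀ A P Q I Pk n e n' e' →
    ((A +P P *P (I +P Pk)) *P n -P (P *P Pk) *P e) *P n' -P n *P (A *P n' -P Q *P e')
    ≋ P *P I *P n *P n' +P P *P Pk *P (n -P e) *P n' +P Q *P n *P e'
  identity = PolyRingSolver.solve-∀ Poly-almostCommutativeRing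
  det≋ : det (stepq (suc (suc a) ℕ.+ k) (n , e)) (stepq (suc a) (n' , e'))
         ≋ P *P qint k *P n *P n' +P P *P qpow k *P (n -P e) *P n' +P qpow a *P n *P e'
  det≋ = ≋-trans (det-cong (+P-cong (*P-congˡ n qint-split) (negP-cong (*P-congˡ e (qpow-+ (suc a) k))) , ≋-refl {n})
                           (≋-refl {proj₁ (stepq (suc a) (n' , e'))} , ≋-refl {n'}))
                 (identity A P (qpow a) (qint k) (qpow k) n e n' e')

det-cfq-nonNeg : ∀ {ds ds'} → All (2 ℕ.≤_) ds → All (2 ℕ.≤_) ds' → cfℤ ds ≻ cfℤ ds' →
  NonNeg (det (cfq ds) (cfq ds'))
det-cfq-nonNeg {[]} {ds'} _ hs' _ = nonNeg-cong (≋-sym (det-∞ (cfq ds'))) (den-nonNeg (cfq-wellShaped hs'))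
det-cfq-nonNeg {d ∷ ts} {[]} hs _ gt = contradiction gt (≻-∞-impossible {cfℤ (d ∷ ts)} (proj₁ (cfℤ-aboveOne hs)))
det-cfq-nonNeg {d ∷ ts} {d' ∷ ts'} (2≤d ∷ hs) (2≤d' ∷ hs') gt =
  nonNeg-cong (≋-sym (det-cong (cfq-∷ d ts) (cfq-∷ d' ts')))
              (compare-heads (ℕ.<-cmp d d') (subst₂ _≻_ (cfℤ-∷ d ts) (cfℤ-∷ d' ts') gt))
  where
  compare-heads : Tri (d ℕ.< d') (d ≡ d') (d' ℕ.< d) → stepℤ d (cfℤ ts) ≻ stepℤ d' (cfℤ ts') →
    NonNeg (det (stepq d (cfq ts)) (stepq d' (cfq ts')))
  compare-heads (tri< d<d' _ _) gt = contradiction gt (stepℤ-≻-head _ _ d<d' (cfℤ-aboveOne hs) (cfℤ-aboveOne hs'))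
  compare-heads (tri≈ _ refl _) gt = nonNeg-cong (≋-sym (det-stepq d (cfq ts) (cfq ts')))
    (nonNeg-*P (nonNeg-qpow (d ∸ 1)) (det-cfq-nonNeg hs hs' (stepℤ-≻-tail d _ _ gt)))
  compare-heads (tri> _ _ d'<d) _ = det-stepq-nonNeg d'<d (ℕ.<⇒≤ 2≤d') (cfq-wellShaped hs) (cfq-wellShaped hs')

cfq-bezout : ∀ ds → Σ (Poly × Poly) λ y → Σ ℕ λ m → det (cfq ds) y ≋ qpow m
cfq-bezout []       = ([] , + 1 ∷ []) , 0 , det-∞ ([] , + 1 ∷ [])
cfq-bezout (d ∷ ds) =
  let y , m , det≋qpow = cfq-bezout ds in
  stepq d y , d ∸ 1 ℕ.+ m ,
  ≋-trans (det-cong (cfq-∷ d ds) (≋-refl , ≋-refl))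
  (≋-trans (det-stepq d (cfq ds) y) (≋-trans (*P-congʳ (qpow (d ∸ 1)) det≋qpow) (≋-sym (qpow-+ (d ∸ 1) m))))

coeff-*P-zero : ∀ p r → coeff (p *P r) 0 ≡ coeff p 0 ℤ.* coeff r 0
coeff-*P-zero []      r = sym (ℤ.*-zeroˡ (coeff r 0))
coeff-*P-zero (a ∷ p) r = trans (coeff-+P (a ·P r) (+ 0 ∷ p *P r) 0) (trans (ℤ.+-identityʳ _) (coeff-·P a r 0))

qpow-divides : ∀ n m b r → coeff n 0 ≡ + 1 → n *P b ≋ qpow m *P r → Σ Poly λ a → b ≋ qpow m *P a
qpow-divides n zero    b       r _  _ = b , ≋-sym (*P-identityˡ b)
qpow-divides n (suc m) []      r _  _ = [] , ≋-sym (*P-zeroʳ (qpow (suc m)))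
qpow-divides n (suc m) (c ∷ b) r n₀ nb≋ =
  let a , b≋ = qpow-divides n m b r n₀ (∷-injectiveʳ (≋-trans (≋-sym n*cb≋) (≋-trans nb≋ (0∷-*P (qpow m) r)))) in
  a , ≋-trans (∷-cong c≡0 b≋) (≋-sym (0∷-*P (qpow m) a))
  where
  c≡0 : c ≡ + 0
  c≡0 = begin
    c                        ≡⟨ ℤ.*-identityˡ c ⟨
    + 1 ℤ.* c                ≡⟨ cong (ℤ._* c) n₀ ⟨
    coeff n 0 ℤ.* c          ≡⟨ coeff-*P-zero n (c ∷ b) ⟨
    coeff (n *P (c ∷ b)) 0   ≡⟨ at (≋-trans nb≋ (0∷-*P (qpow m) r)) 0 ⟩
    + 0                      ∎
    where open ≡-Reasoning
  n*cb≋ : n *P (c ∷ b) ≋ + 0 ∷ n *P b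
  n*cb≋ = ≋-trans (*P-∷ʳ n c b) (+P-cong (subst (λ c → c ·P n ≋ []) (sym c≡0) (0·P-null n)) (≋-refl {+ 0 ∷ n *P b}))

qpow-cancelˡ : ∀ m {p p'} → qpow m *P p ≋ qpow m *P p' → p ≋ p'
qpow-cancelˡ zero    {p} {p'} e = ≋-trans (≋-sym (*P-identityˡ p)) (≋-trans e (*P-identityˡ p'))
qpow-cancelˡ (suc m) {p} {p'} e =
  qpow-cancelˡ m (∷-injectiveʳ (≋-trans (≋-sym (0∷-*P (qpow m) p)) (≋-trans e (0∷-*P (qpow m) p'))))

common-factor : ∀ {n d y m r s} → coeff n 0 ≡ + 1 → det (n , d) y ≋ qpow m → r *P d ≋ s *P n →
  Σ Poly λ a → a *P n ≋ r × a *P d ≋ s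
common-factor {n} {d} {v , u} {m} {r} {s} n₀ det≋qpow rd≋sn =
  a , factor n*b≋ , factor (multiple d s u (split₂ n d r s u v))
  where
  open SetoidReasoning (CommutativeRing.setoid Poly-commutativeRing)
  b = r *P u -P s *P v
  multiple : ∀ x t c → x *P b ≋ t *P det (n , d) (v , u) +P c *P (r *P d -P s *P n) → x *P b ≋ qpow m *P t
  multiple x t c x*b≋ = begin
    x *P b                                                ≈⟨ x*b≋ ⟩
    t *P det (n , d) (v , u) +P c *P (r *P d -P s *P n)   ≈⟨ +P-cong (*P-congʳ t det≋qpow) (*P-congʳ c rd-sn≋[]) ⟩
    t *P qpow m +P c *P []                                ≈⟨ identity t (qpow m) c ⟩
    qpow m *P t                                           ∎
    where
    rd-sn≋[] : r *P d -P s *P n ≋ []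
    rd-sn≋[] = ≋-trans (+P-cong rd≋sn ≋-refl) (+P-inverseʳ (s *P n))
    identity : ∀ t Q c → t *P Q +P c *P [] ≋ Q *P t
    identity = PolyRingSolver.solve-∀ Poly-almostCommutativeRing
  split₁ : ∀ n d r s u v → n *P (r *P u -P s *P v) ≋ r *P (n *P u -P d *P v) +P v *P (r *P d -P s *P n)
  split₁ = PolyRingSolver.solve-∀ Poly-almostCommutativeRing
  split₂ : ∀ n d r s u v → d *P (r *P u -P s *P v) ≋ s *P (n *P u -P d *P v) +P u *P (r *P d -P s *P n)
  split₂ = PolyRingSolver.solve-∀ Poly-almostCommutativeRing
  n*b≋ = multiple n r v (split₁ n d r s u v)
  q^m∣b = qpow-divides n m b r n₀ n*b≋
  a = proj₁ q^m∣b
  factor : ∀ {x t} → x *P b ≋ qpow m *P t → a *P x ≋ t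
  factor {x} {t} x*b≋ = qpow-cancelˡ m (begin
    qpow m *P (a *P x)  ≈⟨ swap (qpow m) a x ⟩
    x *P (qpow m *P a)  ≈⟨ *P-congʳ x (≋-sym (proj₂ q^m∣b)) ⟩
    x *P b              ≈⟨ x*b≋ ⟩
    qpow m *P t         ∎)
    where
    swap : ∀ Q a x → Q *P (a *P x) ≋ x *P (Q *P a)
    swap = PolyRingSolver.solve-∀ Poly-almostCommutativeRing

ev1-null : ∀ {p} → p ≋ [] → ev1 p ≡ + 0
ev1-null {[]}    _ = refl
ev1-null {a ∷ p} e = cong₂ ℤ._+_ (at e 0) (ev1-null {p} (coeffwise λ i → at e (suc i)))

ev1-cong : ∀ {p p'} → p ≋ p' → ev1 p ≡ ev1 p'
ev1-cong {[]}    {p'}     e = sym (ev1-null (≋-sym e))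
ev1-cong {a ∷ p} {[]}     e = ev1-null e
ev1-cong {a ∷ p} {b ∷ p'} e = cong₂ ℤ._+_ (at e 0) (ev1-cong (∷-injectiveʳ e))

ev1-negP : ∀ p → ev1 (negP p) ≡ - ev1 p
ev1-negP []      = refl
ev1-negP (a ∷ p) = trans (cong (ℤ._+_ (- a)) (ev1-negP p)) (sym (ℤ.neg-distrib-+ a (ev1 p)))

ev1-nonNeg : ∀ {p} → NonNeg p → + 0 ℤ.≤ ev1 p
ev1-nonNeg {[]}    _ = 0≤+ 0
ev1-nonNeg {a ∷ p} h = +-pres-0≤ (coeff-nonNeg h 0) (ev1-nonNeg {p} (nonNeg λ i → coeff-nonNeg h (suc i)))

isQRat⇒≋²cfq : ∀ r s c cs R S → 0 < r → All (2 ℕ.≤_) (c ∷ cs) → IsQRat r s c cs R S → (R , S) ≋² cfq (c ∷ cs)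
isQRat⇒≋²cfq r s c cs R S 0<r valid (ev1R≡r , _ , coprime , RD≈SN) =
  [ (λ a≈1 → ≋-trans (≋-sym a*n≋R) (unit a≈1 n) , ≋-trans (≋-sym a*d≋S) (unit a≈1 d))
  , (λ a≈-1 → contradiction (r≤0 a≈-1) (ℤ.<⇒≱ (ℤ.+<+ 0<r))) ]′
  (coprime a n d (at a*n≋R) (at a*d≋S))
  where
  n = proj₁ (cfq (c ∷ cs))
  d = proj₂ (cfq (c ∷ cs))
  w = cfq-wellShaped valid
  factorisation = common-factor (num-constant w) (proj₂ (proj₂ (cfq-bezout (c ∷ cs)))) (coeffwise RD≈SN)
  a = proj₁ factorisation
  a*n≋R = proj₁ (proj₂ factorisation)
  a*d≋S = proj₂ (proj₂ factorisation)
  unit : a ≈P (+ 1 ∷ []) → ∀ x → a *P x ≋ x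
  unit a≈1 x = ≋-trans (*P-congˡ x (coeffwise {a} a≈1)) (*P-identityˡ x)
  r≤0 : a ≈P (- (+ 1) ∷ []) → + r ℤ.≤ + 0
  r≤0 a≈-1 = subst (ℤ._≤ + 0) (trans (sym (ev1-negP n)) (trans (sym (ev1-cong R≋-n)) ev1R≡r))
                   (ℤ.neg-mono-≤ (ev1-nonNeg (num-nonNeg w)))
    where
    negate : ∀ n → (- (+ 1) ∷ []) *P n ≋ negP n
    negate = PolyRingSolver.solve-∀ Poly-almostCommutativeRing
    R≋-n : R ≋ negP n
    R≋-n = ≋-trans (≋-sym a*n≋R) (≋-trans (*P-congˡ n (coeffwise {a} a≈-1)) (negate n))

theorem1p5 : (r s r' s' : ℕ) → 0 < s → 0 < s' → Coprime r s → Coprime r' s' →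
    s < r → s' < r' → r' * s < r * s' →
    (c : ℕ) (cs : List ℕ) → IsNCF r s c cs →
    (c' : ℕ) (cs' : List ℕ) → IsNCF r' s' c' cs' →
    (R S R' S' : Poly) → IsQRat r s c cs R S → IsQRat r' s' c' cs' R' S' →
    ∀ i → + 0 ℤ.≤ coeff (R *P S' -P S *P R') i
theorem1p5 r s r' s' _ _ _ _ s<r s'<r' r's<rs' c cs (valid , rd≡sn) c' cs' (valid' , r'd'≡s'n') R S R' S' qrat qrat' =
  coeff-nonNeg (nonNeg-cong (≋-sym 𝒳≋det) (det-cfq-nonNeg valid valid' cf≻cf'))
  where
  𝒳≋det : R *P S' -P S *P R' ≋ det (cfq (c ∷ cs)) (cfq (c' ∷ cs'))
  𝒳≋det = det-cong (isQRat⇒≋²cfq r s c cs R S (ℕ.m<n⇒0<n s<r) valid qrat)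
                   (isQRat⇒≋²cfq r' s' c' cs' R' S' (ℕ.m<n⇒0<n s'<r') valid' qrat')
  cf≻cf' : cfℤ (c ∷ cs) ≻ cfℤ (c' ∷ cs')
  cf≻cf' = ratio-≻ r s r' s' (cfℤ (c ∷ cs)) (cfℤ (c' ∷ cs')) (cfℤ-den-pos valid) (cfℤ-den-pos valid') rd≡sn r'd'≡s'n' r's<rs'
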